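{- For any graph $F$, any integer $r\ge 1$ and any integer $b\ge 1$, we have $E'_r(F_b)=b^2E'_r(F)$.
   Context: $E'_r(G)$ denotes the minimum number of edges that must be deleted from $G$ to make it $r$-colorable. The $b$-blowup $F_b$ of $F$ is obtained by replacing each vertex $v\in V(F)$ by an independent set $I_v$ of size $b$, and each edge $(u,v)\in E(F)$ by a complete bipartite graph between $I_u$ and $I_v$. -}

module Defs where

open import Data.Nat using (ℕ; _*_; _≤_; _<ᵇ_)
open import Data.Fin using (Fin; toℕ; quotient)
open import Data.Bool using (Bool; true; false; _∧_; not; if_then_else_)
open import Data.Nat.ListAction using (sum)
open import Data.List using (List; map; cartesianProduct; allFin)
open import Data.Product using (_×_; _,_; Σ; ∃)
open import Relation.Binary.PropositionalEquality using (_≡_; _≢_)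

record Graph : Set where
  field
    n     : ℕ
    adj   : Fin n → Fin n → Bool
    sym   : ∀ i j → adj i j ≡ adj j i
    irref : ∀ i → adj i i ≡ false
open Graph public

pairCount : (m : ℕ) → (Fin m → Fin m → Bool) → ℕ
pairCount m f =
  sum (map (λ { (i , j) → if (toℕ i <ᵇ toℕ j) ∧ f i j then 1 else 0 })
           (cartesianProduct (allFin m) (allFin m)))

edges : Graph → ℕ
edges G = pairCount (n G) (adj G)

record EdgeSet (G : Graph) : Set where
  field
    del    : Fin (n G) → Fin (n G) → Bool
    delSym : ∀ i j → del i j ≡ del j i
    del⊆   : ∀ i j → del i j ≡ true → adj G i j ≡ true
open EdgeSet public

size : {G : Graph} → EdgeSet G → ℕ
size {G} D = pairCount (n G) (del D)

ColorableAfterDeleting : (G : Graph) → (r : ℕ) → EdgeSet G → Set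
ColorableAfterDeleting G r D =
  Σ (Fin (n G) → Fin r) λ c →
    ∀ i j → adj G i j ∧ not (del D i j) ≡ true → c i ≢ c j

IsE' : (r : ℕ) → (G : Graph) → (k : ℕ) → Set
IsE' r G k =
  (Σ (EdgeSet G) λ D → size D ≡ k × ColorableAfterDeleting G r D)
  × (∀ (D : EdgeSet G) → ColorableAfterDeleting G r D → k ≤ size D)

-- The b-blowup F_b: vertex set Fin (n * b) ≅ Fin n × Fin b (via quotient),
-- vertex x lies in the independent set I_v with v = quotient b x, and
-- x ~ y iff their classes are adjacent in F.
blowup : Graph → ℕ → Graph
blowup F b = record
  { n     = n F * b
  ; adj   = λ x y → adj F (quotient b x) (quotient b y)
  ; sym   = λ x y → sym F (quotient b x) (quotient b y)
  ; irref = λ x → irref F (quotient b x)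
  }

-- Deleting the lift of an optimal edge set of F leaves F_b r-colourable and costs b² times as much,
-- so E'_r(F_b) ≤ b² E'_r(F).  Conversely, an r-colouring C of F_b must delete every monochromatic
-- edge, and the number of these is a symmetric "energy" in the colour rows C u = (C (u,i))_{i<b}.
-- Fixing all rows but the row of u, this energy is an affine function of the multiset of colours on
-- that row (F_b has no edges inside a class), so replacing the whole row by copies of its best colour
-- does not increase it.  Flattening every row in turn yields a colouring of F whose monochromatic
-- edges, blown up, number at most those of C; hence E'_r(F_b) ≥ b² E'_r(F).
module Submission where

open import Defs hiding (sym)
open import Data.Nat using (ℕ; zero; suc; _+_; _*_; _≤_; _<_; _<ᵇ_; z≤n)
open import Data.Nat.Properties
  using (≤-refl; ≤-trans; +-mono-≤; +-monoˡ-≤; *-monoʳ-≤; +-assoc; +-identityʳ; *-zeroʳ;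
         *-cancelˡ-≡; *-cancelˡ-≤; <-cmp; <⇒<ᵇ; <ᵇ⇒<; +-*-semiring; module ≤-Reasoning)
open import Data.Nat.Tactic.RingSolver using (solve-∀)
import Data.Nat.ListAction as List
open import Data.Nat.ListAction.Properties using (sum-++)
open import Algebra.Properties.Semiring.Sum +-*-semiring
  using (sum; sum-syntax; sum-cong-≗; sum-remove; ∑-distrib-+; ∑-comm; *-distribˡ-sum)
open import Data.Fin using (Fin; toℕ; quotient; combine; _↑ˡ_; _↑ʳ_; punchIn; punchOut; _≟_)
open import Data.Fin.Properties using (remQuot-combine; toℕ-injective; punchIn-punchOut)
open import Data.Vec.Functional using (insertAt; removeAt)
open import Data.Vec.Functional.Properties using (insertAt-lookup; insertAt-punchIn; insertAt-removeAt)
open import Data.Bool using (Bool; true; false; _∧_; not; if_then_else_)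
open import Data.Bool.Properties using (∧-identityʳ; ∧-inverseʳ; ∧-zeroʳ)
open import Data.List using (List; []; _∷_; _++_; map; cartesianProduct; allFin; tabulate)
open import Data.List.Properties using (map-++; map-∘)
open import Data.List.Relation.Unary.All as All using (All; []; _∷_)
open import Data.List.Membership.Propositional.Properties using (∈-allFin)
open import Data.List.Extrema.Nat using (argmin; f[argmin]≤f[xs])
open import Data.Product using (Σ; _×_; _,_; proj₁; proj₂; ∃-syntax)
open import Function using (_∘_)
open import Relation.Nullary using (¬_; does; yes; no; contradiction)
open import Relation.Nullary.Decidable using (dec-true)
open import Relation.Binary.PropositionalEquality
open import Relation.Binary.Definitions using (tri<; tri≈; tri>)

indicator : Bool → ℕ
indicator b = if b then 1 else 0

indicator-mono : ∀ {a c} → (a ≡ true → c ≡ true) → indicator a ≤ indicator c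
indicator-mono {false} _ = z≤n
indicator-mono {true} a⇒c rewrite a⇒c refl = ≤-refl

∧-true-left : ∀ {a c} → a ∧ c ≡ true → a ≡ true
∧-true-left {true} _ = refl

≟-sym : ∀ {m} (x y : Fin m) → does (x ≟ y) ≡ does (y ≟ x)
≟-sym x y with x ≟ y | y ≟ x
... | yes _  | yes _  = refl
... | no _   | no _   = refl
... | yes x≡y | no y≢x = contradiction (sym x≡y) y≢x
... | no x≢y | yes y≡x = contradiction (sym y≡x) x≢y

insertAt-removeAt-≢ : ∀ {m} {A : Set} (xs : Fin (suc m) → A) {u v} y → u ≢ v →
  insertAt (removeAt xs u) u y v ≡ xs v
insertAt-removeAt-≢ xs {u} {v} y u≢v = begin
  insertAt (removeAt xs u) u y v                 ≡⟨ cong (insertAt (removeAt xs u) u y) (punchIn-punchOut u≢v) ⟨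
  insertAt (removeAt xs u) u y (punchIn u k)     ≡⟨ insertAt-punchIn (removeAt xs u) u y k ⟩
  xs (punchIn u k)                               ≡⟨ cong xs (punchIn-punchOut u≢v) ⟩
  xs v                                           ∎
  where
  open ≡-Reasoning
  k = punchOut u≢v

∑-const : ∀ n x → ∑[ i < n ] x ≡ n * x
∑-const zero    x = refl
∑-const (suc n) x = cong (x +_) (∑-const n x)

∑-mono-≤ : ∀ {n} {f g : Fin n → ℕ} → (∀ i → f i ≤ g i) → sum f ≤ sum g
∑-mono-≤ {zero}  _   = z≤n
∑-mono-≤ {suc n} f≤g = +-mono-≤ (f≤g Fin.zero) (∑-mono-≤ (f≤g ∘ Fin.suc))

∑-zero : ∀ n → ∑[ _ < n ] 0 ≡ 0
∑-zero n = trans (∑-const n 0) (*-zeroʳ n)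

∑-*ˡ : ∀ {n} x (f : Fin n → ℕ) → ∑[ i < n ] (x * f i) ≡ x * sum f
∑-*ˡ x f = sym (*-distribˡ-sum x f)

∑-↑ : ∀ m n (f : Fin (m + n) → ℕ) → sum f ≡ ∑[ i < m ] f (i ↑ˡ n) + ∑[ j < n ] f (m ↑ʳ j)
∑-↑ zero    n f = refl
∑-↑ (suc m) n f = trans (cong (f Fin.zero +_) (∑-↑ m n (f ∘ Fin.suc)))
                        (sym (+-assoc (f Fin.zero) _ _))

∑-combine : ∀ m n (f : Fin (m * n) → ℕ) → sum f ≡ ∑[ u < m ] ∑[ i < n ] f (combine u i)
∑-combine zero    n f = refl
∑-combine (suc m) n f = trans (∑-↑ n (m * n) f)
  (cong (∑[ i < n ] f (i ↑ˡ (m * n)) +_) (∑-combine m n (f ∘ (n ↑ʳ_))))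

min≤mean : ∀ {n} (f : Fin (suc n) → ℕ) → ∃[ i ] suc n * f i ≤ sum f
min≤mean {n} f = i , (begin
  suc n * f i          ≡⟨ ∑-const (suc n) (f i) ⟨
  ∑[ _ < suc n ] f i   ≤⟨ ∑-mono-≤ (λ j → All.lookup (f[argmin]≤f[xs] {f = f} Fin.zero (allFin (suc n))) (∈-allFin j)) ⟩
  sum f                ∎)
  where
  open ≤-Reasoning
  i = argmin f Fin.zero (allFin (suc n))

arcs : (m : ℕ) → (Fin m → Fin m → Bool) → ℕ
arcs m f = ∑[ i < m ] ∑[ j < m ] indicator (f i j)

sum-cartesianProduct : ∀ {A B : Set} (h : A × B → ℕ) (xs : List A) (ys : List B) →
  List.sum (map h (cartesianProduct xs ys)) ≡ List.sum (map (λ x → List.sum (map (λ y → h (x , y)) ys)) xs)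
sum-cartesianProduct h []       ys = refl
sum-cartesianProduct h (x ∷ xs) ys = begin
  List.sum (map h (map (x ,_) ys ++ cartesianProduct xs ys))
    ≡⟨ cong List.sum (map-++ h (map (x ,_) ys) (cartesianProduct xs ys)) ⟩
  List.sum (map h (map (x ,_) ys) ++ map h (cartesianProduct xs ys))
    ≡⟨ sum-++ (map h (map (x ,_) ys)) (map h (cartesianProduct xs ys)) ⟩
  List.sum (map h (map (x ,_) ys)) + List.sum (map h (cartesianProduct xs ys))
    ≡⟨ cong₂ _+_ (cong List.sum (sym (map-∘ ys))) (sum-cartesianProduct h xs ys) ⟩
  List.sum (map (λ y → h (x , y)) ys) + List.sum (map (λ x → List.sum (map (λ y → h (x , y)) ys)) xs) ∎
  where open ≡-Reasoning

sum-map-tabulate : ∀ m {A : Set} (f : A → ℕ) (g : Fin m → A) →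
  List.sum (map f (tabulate g)) ≡ ∑[ i < m ] f (g i)
sum-map-tabulate zero    f g = refl
sum-map-tabulate (suc m) f g = cong (f (g Fin.zero) +_) (sum-map-tabulate m f (g ∘ Fin.suc))

pairCount≡∑ : ∀ m f → pairCount m f ≡ ∑[ i < m ] ∑[ j < m ] indicator ((toℕ i <ᵇ toℕ j) ∧ f i j)
pairCount≡∑ m f = trans (sum-cartesianProduct _ (allFin m) (allFin m))
  (trans (sum-map-tabulate m _ (λ i → i))
         (sum-cong-≗ {m} (λ i → sum-map-tabulate m (λ j → indicator ((toℕ i <ᵇ toℕ j) ∧ f i j)) (λ j → j))))

<ᵇ-true : ∀ {x y} → x < y → (x <ᵇ y) ≡ true
<ᵇ-true {x} {y} x<y with x <ᵇ y | <⇒<ᵇ x<y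
... | true | _ = refl

<ᵇ-false : ∀ {x y} → ¬ x < y → (x <ᵇ y) ≡ false
<ᵇ-false {x} {y} x≮y with x <ᵇ y | <ᵇ⇒< x y
... | true  | x<y = contradiction (x<y _) x≮y
... | false | _   = refl

indicator-split : ∀ {m} (f : Fin m → Fin m → Bool) → (∀ i j → f i j ≡ f j i) → (∀ i → f i i ≡ false) →
  ∀ i j → indicator (f i j) ≡ indicator ((toℕ i <ᵇ toℕ j) ∧ f i j) + indicator ((toℕ j <ᵇ toℕ i) ∧ f j i)
indicator-split f f-sym f-irrefl i j with <-cmp (toℕ i) (toℕ j)
... | tri< i<j _ j≮i rewrite <ᵇ-true i<j | <ᵇ-false j≮i = sym (+-identityʳ _)
... | tri≈ i≮j i≡j j≮i rewrite <ᵇ-false i≮j | <ᵇ-false j≮i =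
  cong indicator (trans (cong (f i) (sym (toℕ-injective i≡j))) (f-irrefl i))
... | tri> i≮j _ j<i rewrite <ᵇ-false i≮j | <ᵇ-true j<i = cong indicator (f-sym i j)

arcs≡2*pairCount : ∀ m (f : Fin m → Fin m → Bool) → (∀ i j → f i j ≡ f j i) → (∀ i → f i i ≡ false) →
  arcs m f ≡ 2 * pairCount m f
arcs≡2*pairCount m f f-sym f-irrefl = begin
  arcs m f
    ≡⟨ sum-cong-≗ (λ i → trans (sum-cong-≗ (indicator-split f f-sym f-irrefl i)) (∑-distrib-+ (P i) (λ j → P j i))) ⟩
  ∑[ i < m ] (sum (P i) + ∑[ j < m ] P j i)
    ≡⟨ ∑-distrib-+ (sum ∘ P) (λ i → ∑[ j < m ] P j i) ⟩
  ∑[ i < m ] sum (P i) + ∑[ i < m ] ∑[ j < m ] P j i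
    ≡⟨ cong (∑[ i < m ] sum (P i) +_) (∑-comm P) ⟨
  ∑[ i < m ] sum (P i) + ∑[ i < m ] sum (P i)
    ≡⟨ cong (λ x → x + x) (pairCount≡∑ m f) ⟨
  pairCount m f + pairCount m f
    ≡⟨ cong (pairCount m f +_) (+-identityʳ _) ⟨
  2 * pairCount m f ∎
  where
  open ≡-Reasoning
  P : Fin m → Fin m → ℕ
  P i j = indicator ((toℕ i <ᵇ toℕ j) ∧ f i j)

quotient-combine : ∀ {m} b (u : Fin m) (i : Fin b) → quotient b (combine u i) ≡ u
quotient-combine b u i = cong proj₁ (remQuot-combine u i)

arcs-combine : ∀ m b (f : Fin (m * b) → Fin (m * b) → Bool) →
  arcs (m * b) f ≡ ∑[ u < m ] ∑[ v < m ] ∑[ i < b ] ∑[ j < b ] indicator (f (combine u i) (combine v j))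
arcs-combine m b f = trans (∑-combine m b (λ x → ∑[ y < m * b ] indicator (f x y)))
  (sum-cong-≗ {m} (λ u → trans (sum-cong-≗ {b} (λ i → ∑-combine m b (λ y → indicator (f (combine u i) y))))
                           (∑-comm {b} {m} (λ i v → ∑[ j < b ] indicator (f (combine u i) (combine v j))))))

∑-blocks-const : ∀ {m} b (g : Fin m → Fin m → ℕ) →
  ∑[ u < m ] ∑[ v < m ] ∑[ i < b ] ∑[ j < b ] g u v ≡ b * (b * ∑[ u < m ] ∑[ v < m ] g u v)
∑-blocks-const {m} b g = begin
  ∑[ u < m ] ∑[ v < m ] ∑[ i < b ] ∑[ j < b ] g u v
    ≡⟨ sum-cong-≗ {m} (λ u → sum-cong-≗ {m} (λ v → trans (sum-cong-≗ {b} (λ _ → ∑-const b (g u v))) (∑-const b _))) ⟩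
  ∑[ u < m ] ∑[ v < m ] (b * (b * g u v))
    ≡⟨ sum-cong-≗ {m} (λ u → trans (∑-*ˡ {m} b _) (cong (b *_) (∑-*ˡ b (g u)))) ⟩
  ∑[ u < m ] (b * (b * ∑[ v < m ] g u v))
    ≡⟨ trans (∑-*ˡ {m} b _) (cong (b *_) (∑-*ˡ {m} b _)) ⟩
  b * (b * ∑[ u < m ] ∑[ v < m ] g u v) ∎
  where open ≡-Reasoning

arcs-quotient : ∀ m b (g : Fin m → Fin m → Fin (m * b) → Fin (m * b) → Bool) →
  arcs (m * b) (λ x y → g (quotient b x) (quotient b y) x y)
    ≡ ∑[ u < m ] ∑[ v < m ] ∑[ i < b ] ∑[ j < b ] indicator (g u v (combine u i) (combine v j))
arcs-quotient m b g = trans (arcs-combine m b _)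
  (sum-cong-≗ {m} (λ u → sum-cong-≗ {m} (λ v → sum-cong-≗ {b} (λ i → sum-cong-≗ {b} (λ j →
    cong indicator (cong₂ (λ u′ v′ → g u′ v′ (combine u i) (combine v j))
                          (quotient-combine b u i) (quotient-combine b v j)))))))

arcs-blowup : ∀ m b (f : Fin m → Fin m → Bool) →
  arcs (m * b) (λ x y → f (quotient b x) (quotient b y)) ≡ b * (b * arcs m f)
arcs-blowup m b f = trans (arcs-quotient m b (λ u v _ _ → f u v)) (∑-blocks-const b (λ u v → indicator (f u v)))

-- Energies of pair weights

Weight : Set → ℕ → Set
Weight X n = Fin n → X → Fin n → X → ℕ

module _ {X : Set} where

  Symmetric : ∀ {n} → Weight X n → Set
  Symmetric W = ∀ u x v y → W u x v y ≡ W v y u x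

  Loopless : ∀ {n} → Weight X n → Set
  Loopless W = ∀ u x y → W u x u y ≡ 0

  energy : ∀ {n} → Weight X n → (Fin n → X) → ℕ
  energy {n} W c = ∑[ u < n ] ∑[ v < n ] W u (c u) v (c v)

  removeVertex : ∀ {m} → Weight X (suc m) → Fin (suc m) → Weight X m
  removeVertex W u k x l y = W (punchIn u k) x (punchIn u l) y

  interaction : ∀ {m} → Weight X (suc m) → Fin (suc m) → X → (Fin m → X) → ℕ
  interaction {m} W u x c = ∑[ k < m ] W u x (punchIn u k) (c k)

  energy-insertAt : ∀ {m} {W : Weight X (suc m)} → Symmetric W → Loopless W →
    ∀ (c : Fin m → X) u x → energy W (insertAt c u x) ≡ 2 * interaction W u x c + energy (removeVertex W u) c
  energy-insertAt {m} {W} W-sym W-loopless c u x = begin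
    energy W c⁺
      ≡⟨ sum-remove {i = u} (λ v → ∑[ v' < suc m ] T v v') ⟩
    ∑[ v' < suc m ] T u v' + ∑[ k < m ] ∑[ v' < suc m ] T (punchIn u k) v'
      ≡⟨ cong₂ _+_ (sum-remove {i = u} (T u)) (sum-cong-≗ {m} (λ k → sum-remove {i = u} (T (punchIn u k)))) ⟩
    (T u u + I) + ∑[ k < m ] (T (punchIn u k) u + ∑[ l < m ] T (punchIn u k) (punchIn u l))
      ≡⟨ cong₂ _+_ (cong (_+ I) (W-loopless u (c⁺ u) (c⁺ u)))
                   (∑-distrib-+ (λ k → T (punchIn u k) u) (λ k → ∑[ l < m ] T (punchIn u k) (punchIn u l))) ⟩
    I + (∑[ k < m ] T (punchIn u k) u + B)
      ≡⟨ cong (λ z → I + (z + B)) (sum-cong-≗ {m} (λ k → W-sym _ _ _ _)) ⟩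
    I + (I + B)
      ≡⟨ cong₂ (λ a b → a + (a + b)) I≡interaction B≡energy ⟩
    interaction W u x c + (interaction W u x c + energy (removeVertex W u) c)
      ≡⟨ double (interaction W u x c) _ ⟩
    2 * interaction W u x c + energy (removeVertex W u) c ∎
    where
    open ≡-Reasoning
    c⁺ = insertAt c u x
    T : Fin (suc m) → Fin (suc m) → ℕ
    T v v' = W v (c⁺ v) v' (c⁺ v')
    c⁺-punchIn : ∀ k → c⁺ (punchIn u k) ≡ c k
    c⁺-punchIn = insertAt-punchIn c u x
    I B : ℕ
    I = ∑[ k < m ] T u (punchIn u k)
    B = ∑[ k < m ] ∑[ l < m ] T (punchIn u k) (punchIn u l)
    I≡interaction : I ≡ interaction W u x c
    I≡interaction = sum-cong-≗ {m} (λ k →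
      cong₂ (λ y z → W u y (punchIn u k) z) (insertAt-lookup c u x) (c⁺-punchIn k))
    B≡energy : B ≡ energy (removeVertex W u) c
    B≡energy = sum-cong-≗ {m} (λ k → sum-cong-≗ {m} (λ l →
      cong₂ (λ y z → W (punchIn u k) y (punchIn u l) z) (c⁺-punchIn k) (c⁺-punchIn l)))
    double : ∀ a b → a + (a + b) ≡ 2 * a + b
    double = solve-∀

module _ {X : Set} where

  blockWeight : ∀ {n b} → Weight X n → Weight (Fin b → X) n
  blockWeight {b = b} w u ρ v σ = ∑[ i < b ] ∑[ j < b ] w u (ρ i) v (σ j)

  blockWeight-symmetric : ∀ {n b} {w : Weight X n} → Symmetric w → Symmetric (blockWeight {b = b} w)
  blockWeight-symmetric {b = b} w-sym u ρ v σ =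
    trans (∑-comm {b} {b} _) (sum-cong-≗ {b} (λ j → sum-cong-≗ {b} (λ i → w-sym u (ρ i) v (σ j))))

  blockWeight-loopless : ∀ {n b} {w : Weight X n} → Loopless w → Loopless (blockWeight {b = b} w)
  blockWeight-loopless {b = b} w-loopless u ρ σ =
    trans (sum-cong-≗ {b} (λ i → trans (sum-cong-≗ {b} (λ j → w-loopless u (ρ i) (σ j))) (∑-zero b))) (∑-zero b)

  blockEnergy-cong : ∀ {n b} (w : Weight X n) {C C′ : Fin n → Fin b → X} → (∀ v i → C v i ≡ C′ v i) →
    energy (blockWeight w) C ≡ energy (blockWeight w) C′
  blockEnergy-cong {n} {b} w C≗C′ = sum-cong-≗ {n} (λ u → sum-cong-≗ {n} (λ v →
    sum-cong-≗ {b} (λ i → sum-cong-≗ {b} (λ j → cong₂ (λ x y → w u x v y) (C≗C′ u i) (C≗C′ v j)))))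

  Constant : ∀ {b} → (Fin b → X) → Set
  Constant ρ = ∀ i j → ρ i ≡ ρ j

  -- The interaction of a row is a sum over its entries, so it does not increase when every entry is
  -- replaced by the one of least interaction.
  flatten-row : ∀ {m b} {w : Weight X (suc m)} → Symmetric w → Loopless w →
    ∀ (C : Fin (suc m) → Fin (suc b) → X) u →
    ∃[ i ] energy (blockWeight w) (insertAt (removeAt C u) u (λ _ → C u i)) ≤ energy (blockWeight w) C
  flatten-row {m} {b} {w} w-sym w-loopless C u = i , (begin
    energy W (insertAt R u (λ _ → C u i))
      ≡⟨ energy-insertAt W-sym W-loopless R u (λ _ → C u i) ⟩
    2 * interaction W u (λ _ → C u i) R + energy (removeVertex W u) R
      ≤⟨ +-monoˡ-≤ (energy (removeVertex W u) R) (*-monoʳ-≤ 2 flat≤) ⟩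
    2 * interaction W u (C u) R + energy (removeVertex W u) R
      ≡⟨ energy-insertAt W-sym W-loopless R u (C u) ⟨
    energy W (insertAt R u (C u))
      ≡⟨ blockEnergy-cong w (λ v → cong-app (insertAt-removeAt C u v)) ⟩
    energy W C ∎)
    where
    open ≤-Reasoning
    W = blockWeight {b = suc b} w
    W-sym = blockWeight-symmetric {b = suc b} {w = w} w-sym
    W-loopless = blockWeight-loopless {b = suc b} {w = w} w-loopless
    R = removeAt C u
    h : Fin (suc b) → ℕ
    h i = ∑[ k < m ] ∑[ j < suc b ] w u (C u i) (punchIn u k) (R k j)
    i = proj₁ (min≤mean h)
    mean : suc b * h i ≤ sum h
    mean = proj₂ (min≤mean h)
    interaction-linear : ∀ ρ → interaction W u ρ R ≡ ∑[ i < suc b ] ∑[ k < m ] ∑[ j < suc b ] w u (ρ i) (punchIn u k) (R k j)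
    interaction-linear ρ = ∑-comm {m} {suc b} (λ k i → ∑[ j < suc b ] w u (ρ i) (punchIn u k) (R k j))
    flat≤ : interaction W u (λ _ → C u i) R ≤ interaction W u (C u) R
    flat≤ = begin
      interaction W u (λ _ → C u i) R ≡⟨ interaction-linear (λ _ → C u i) ⟩
      ∑[ _ < suc b ] h i              ≡⟨ ∑-const (suc b) (h i) ⟩
      suc b * h i                     ≤⟨ mean ⟩
      sum h                           ≡⟨ interaction-linear (C u) ⟨
      interaction W u (C u) R         ∎

  constant-insertAt : ∀ {m b} (C : Fin (suc m) → Fin b → X) u x v → (u ≢ v → Constant (C v)) →
    Constant (insertAt (removeAt C u) u (λ _ → x) v)
  constant-insertAt C u x v constant-v with u ≟ v
  ... | yes refl = λ i j → trans (at-u i) (sym (at-u j))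
    where
    at-u : ∀ i → insertAt (removeAt C u) u (λ _ → x) u i ≡ x
    at-u = cong-app (insertAt-lookup (removeAt C u) u (λ _ → x))
  ... | no u≢v rewrite insertAt-removeAt-≢ C (λ _ → x) u≢v = constant-v u≢v

  flatten-rows : ∀ {n b} {w : Weight X n} → Symmetric w → Loopless w →
    ∀ (us : List (Fin n)) (C : Fin n → Fin (suc b) → X) →
    Σ (Fin n → Fin (suc b) → X) λ C′ → energy (blockWeight w) C′ ≤ energy (blockWeight w) C × All (Constant ∘ C′) us
  flatten-rows _ _ [] C = C , ≤-refl , []
  flatten-rows {zero} _ _ (() ∷ _) _
  flatten-rows {suc m} {b} {w} w-sym w-loopless (u ∷ us) C =
    let C′ , C′≤C , constant = flatten-rows {b = b} w-sym w-loopless us C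
        i , flat≤ = flatten-row {w = w} w-sym w-loopless C′ u
    in insertAt (removeAt C′ u) u (λ _ → C′ u i) , ≤-trans flat≤ C′≤C ,
       constant-insertAt C′ u (C′ u i) u (λ u≢u → contradiction refl u≢u) ∷
       All.map (λ {v} constant-v → constant-insertAt C′ u (C′ u i) v (λ _ → constant-v)) constant

  flatten : ∀ {n b} {w : Weight X n} → Symmetric w → Loopless w → ∀ (C : Fin n → Fin (suc b) → X) →
    ∃[ c ] suc b * (suc b * energy w c) ≤ energy (blockWeight w) C
  flatten {n} {b} {w} w-sym w-loopless C = c , (begin
    suc b * (suc b * energy w c)          ≡⟨ ∑-blocks-const {n} (suc b) (λ u v → w u (c u) v (c v)) ⟨
    energy (blockWeight w) flat-C         ≡⟨ blockEnergy-cong w (λ v → All.lookup constant (∈-allFin v) Fin.zero) ⟩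
    energy (blockWeight w) C′             ≤⟨ C′≤C ⟩
    energy (blockWeight w) C              ∎)
    where
    open ≤-Reasoning
    flat = flatten-rows w-sym w-loopless (allFin n) C
    C′ = proj₁ flat
    C′≤C = proj₁ (proj₂ flat)
    constant = proj₂ (proj₂ flat)
    c : Fin n → X
    c v = C′ v Fin.zero
    flat-C : Fin n → Fin (suc b) → X
    flat-C v _ = c v

b*[b*[2*k]]≡2*[b*b*k] : ∀ b k → b * (b * (2 * k)) ≡ 2 * (b * b * k)
b*[b*[2*k]]≡2*[b*b*k] = solve-∀

del-irrefl : ∀ {G} (D : EdgeSet G) i → del D i i ≡ false
del-irrefl {G} D i with del D i i in e
... | true  = contradiction (trans (sym (del⊆ D i i e)) (irref G i)) λ ()
... | false = refl

arcs≡2*size : ∀ {G} (D : EdgeSet G) → arcs (n G) (del D) ≡ 2 * size D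
arcs≡2*size {G} D = arcs≡2*pairCount (n G) (del D) (delSym D) (del-irrefl D)

size-mono : ∀ {G} {D D′ : EdgeSet G} → (∀ x y → del D x y ≡ true → del D′ x y ≡ true) → size D ≤ size D′
size-mono {G} {D} {D′} D⊆D′ = *-cancelˡ-≤ 2 (begin
  2 * size D          ≡⟨ arcs≡2*size D ⟨
  arcs (n G) (del D)  ≤⟨ ∑-mono-≤ (λ x → ∑-mono-≤ (λ y → indicator-mono (D⊆D′ x y))) ⟩
  arcs (n G) (del D′) ≡⟨ arcs≡2*size D′ ⟩
  2 * size D′         ∎)
  where open ≤-Reasoning

liftEdgeSet : ∀ {F} b → EdgeSet F → EdgeSet (blowup F b)
liftEdgeSet b D = record
  { del    = λ x y → del D (quotient b x) (quotient b y)
  ; delSym = λ x y → delSym D (quotient b x) (quotient b y)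
  ; del⊆   = λ x y → del⊆ D (quotient b x) (quotient b y)
  }

size-liftEdgeSet : ∀ {F} b (D : EdgeSet F) → size (liftEdgeSet b D) ≡ b * b * size D
size-liftEdgeSet {F} b D = *-cancelˡ-≡ _ _ 2 (begin
  2 * size (liftEdgeSet b D)              ≡⟨ arcs≡2*size (liftEdgeSet b D) ⟨
  arcs (n F * b) (del (liftEdgeSet b D))  ≡⟨ arcs-blowup (n F) b (del D) ⟩
  b * (b * arcs (n F) (del D))            ≡⟨ cong (λ z → b * (b * z)) (arcs≡2*size D) ⟩
  b * (b * (2 * size D))                  ≡⟨ b*[b*[2*k]]≡2*[b*b*k] b (size D) ⟩
  2 * (b * b * size D)                    ∎)
  where open ≡-Reasoning

colourable-lift : ∀ {F r} b {D : EdgeSet F} →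
  ColorableAfterDeleting F r D → ColorableAfterDeleting (blowup F b) r (liftEdgeSet b D)
colourable-lift b (c , proper) = c ∘ quotient b , λ x y → proper (quotient b x) (quotient b y)

monochromatic : ∀ {r} (G : Graph) → (Fin (n G) → Fin r) → EdgeSet G
monochromatic G c = record
  { del    = λ u v → adj G u v ∧ does (c u ≟ c v)
  ; delSym = λ u v → cong₂ _∧_ (Graph.sym G u v) (≟-sym (c u) (c v))
  ; del⊆   = λ u v → ∧-true-left
  }

colourable-monochromatic : ∀ {r} G (c : Fin (n G) → Fin r) → ColorableAfterDeleting G r (monochromatic G c)
colourable-monochromatic G c = c , proper
  where
  proper : ∀ u v → adj G u v ∧ not (del (monochromatic G c) u v) ≡ true → c u ≢ c v
  proper u v kept cu≡cv rewrite dec-true (c u ≟ c v) cu≡cv =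
    contradiction (trans (sym kept) (trans (cong (λ z → adj G u v ∧ not z) (∧-identityʳ _)) (∧-inverseʳ (adj G u v)))) λ ()

monochromatic-⊆ : ∀ {r} G {D : EdgeSet G} (colouring : ColorableAfterDeleting G r D) →
  ∀ x y → del (monochromatic G (proj₁ colouring)) x y ≡ true → del D x y ≡ true
monochromatic-⊆ G {D} (c , proper) x y mono with del D x y in e | c x ≟ c y
... | true  | _         = refl
... | false | yes cx≡cy = contradiction cx≡cy (proper x y (cong₂ (λ a d → a ∧ not d) (∧-true-left mono) e))
... | false | no _      = contradiction (trans (sym mono) (∧-zeroʳ _)) λ ()

clashWeight : ∀ {r} (G : Graph) → Weight (Fin r) (n G)
clashWeight G u x v y = indicator (adj G u v ∧ does (x ≟ y))

clashWeight-symmetric : ∀ {r} G → Symmetric (clashWeight {r} G)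
clashWeight-symmetric G u x v y = cong indicator (cong₂ _∧_ (Graph.sym G u v) (≟-sym x y))

clashWeight-loopless : ∀ {r} G → Loopless (clashWeight {r} G)
clashWeight-loopless G u x y = cong (λ a → indicator (a ∧ does (x ≟ y))) (irref G u)

monochromatic-blowup : ∀ {r} F b (c′ : Fin (n F * suc b) → Fin r) →
  ∃[ c ] suc b * suc b * size (monochromatic F c) ≤ size (monochromatic (blowup F (suc b)) c′)
monochromatic-blowup F b c′ with flatten (clashWeight-symmetric F) (clashWeight-loopless F) (λ u i → c′ (combine u i))
... | c , flat≤ = c , *-cancelˡ-≤ 2 (begin
  2 * (suc b * suc b * size (monochromatic F c))    ≡⟨ b*[b*[2*k]]≡2*[b*b*k] (suc b) (size (monochromatic F c)) ⟨
  suc b * (suc b * (2 * size (monochromatic F c)))  ≡⟨ cong (λ z → suc b * (suc b * z)) (arcs≡2*size (monochromatic F c)) ⟨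
  suc b * (suc b * energy (clashWeight F) c)        ≤⟨ flat≤ ⟩
  energy (blockWeight (clashWeight F)) (λ u i → c′ (combine u i))
    ≡⟨ arcs-quotient (n F) (suc b) (λ u v x y → adj F u v ∧ does (c′ x ≟ c′ y)) ⟨
  arcs (n F * suc b) (del (monochromatic (blowup F (suc b)) c′))
    ≡⟨ arcs≡2*size (monochromatic (blowup F (suc b)) c′) ⟩
  2 * size (monochromatic (blowup F (suc b)) c′)    ∎)
  where open ≤-Reasoning

claim8p2 : (F : Graph) (r b : ℕ) → 1 ≤ r → 1 ≤ b →
    ∀ k → IsE' r F k → IsE' r (blowup F b) (b * b * k)
claim8p2 F r (suc b) _ _ k ((D , |D|≡k , D-colourable) , D-minimal) =
  (liftEdgeSet (suc b) D , trans (size-liftEdgeSet (suc b) D) (cong (suc b * suc b *_) |D|≡k) ,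
   colourable-lift {F} {r} (suc b) {D} D-colourable) ,
  minimal
  where
  minimal : ∀ D′ → ColorableAfterDeleting (blowup F (suc b)) r D′ → suc b * suc b * k ≤ size D′
  minimal D′ D′-colourable with monochromatic-blowup F b (proj₁ D′-colourable)
  ... | c , blowup≤ = begin
    suc b * suc b * k                         ≤⟨ *-monoʳ-≤ (suc b * suc b) (D-minimal (monochromatic F c) (colourable-monochromatic F c)) ⟩
    suc b * suc b * size (monochromatic F c)  ≤⟨ blowup≤ ⟩
    size mono                                 ≤⟨ size-mono {D = mono} {D′} (monochromatic-⊆ (blowup F (suc b)) {D′} D′-colourable) ⟩
    size D′                                   ∎
    where
    open ≤-Reasoning
    mono = monochromatic (blowup F (suc b)) (proj₁ D′-colourable)
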